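{- Let $[a_0;a_1,\dots,a_{k-1}]$ be the continued fraction expansion of a positive rational number. (1) If $k$ is odd, every integer $n$ with $0\leq n<r_k$ can be written as $n=\sum_{i=0}^{k-1}(-1)^ib_ir_i$ where $(b_i)_{0\le i\le k-1}$ is an admissible sequence. (2) If $k$ is even, every integer $n$ with $r_{k-1}-r_k\leq n<r_{k-1}$ can be written as $n=\sum_{i=0}^{k-1}(-1)^ib_ir_i$ where $(b_i)_{0\le i\le k-1}$ is an admissible sequence.
   Context: $a_0\ge0$, $a_i\ge1$ for $1\le i<k$. $r_{ -1}=r_0=1$ and $r_i=a_{i-1}r_{i-1}+r_{i-2}$ for $1\le i\le k$. A sequence $(b_i)_{0\le i<k}$ of integers is admissible (for $[a_0;\dots,a_{k-1}]$) if $0\le b_i\le a_i$; if $i>0$ is odd and $b_i=a_i$ then $b_{i-1}=a_{i-1}$; if $i>0$ is even and $b_i=0$ then $b_{i-1}=0$. -}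

module Defs where

open import Data.Nat using (ℕ; zero; suc; _+_; _*_; _≤_; _<_; _%_)
open import Data.Integer as ℤ using (ℤ; +_)
open import Data.Product using (_×_)
open import Data.Sum using (_⊎_)
open import Relation.Binary.PropositionalEquality using (_≡_)

-- A finite continued fraction [a_0; a_1, …, a_{k-1}] is given by k and a
-- function a : ℕ → ℕ (only the values a 0, …, a (k-1) are relevant).

-- r a i = r_i, with r_{-1} = r_0 = 1 and r_i = a_{i-1} r_{i-1} + r_{i-2}.
r : (ℕ → ℕ) → ℕ → ℕ
r a zero = 1
r a (suc zero) = a 0 * 1 + 1
r a (suc (suc i)) = a (suc i) * r a (suc i) + r a i

-- Standing conditions on [a_0; …, a_{k-1}] being the continued fraction
-- expansion of a positive rational: k ≥ 1, a_i ≥ 1 for 1 ≤ i < k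
-- (a_0 ≥ 0 automatic in ℕ), and the value is positive (a_0 ≥ 1 or k ≥ 2).
IsPosCF : ℕ → (ℕ → ℕ) → Set
IsPosCF k a = (1 ≤ k) × (∀ i → 1 ≤ i → i < k → 1 ≤ a i) × ((1 ≤ a 0) ⊎ (2 ≤ k))

Odd Even : ℕ → Set
Odd n = n % 2 ≡ 1
Even n = n % 2 ≡ 0

Admissible : ℕ → (ℕ → ℕ) → (ℕ → ℕ) → Set
Admissible k a b =
  (∀ i → i < k → b i ≤ a i)
  × (∀ i → suc i < k → Odd (suc i) → b (suc i) ≡ a (suc i) → b i ≡ a i)
  × (∀ i → suc i < k → Even (suc i) → b (suc i) ≡ 0 → b i ≡ 0)

altSum : (ℕ → ℕ) → (ℕ → ℕ) → ℕ → ℤ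
altSum a b zero = + 0
altSum a b (suc m) = altSum a b m ℤ.+ sgn m (+ (b m * r a m))
  where
  sgn : ℕ → ℤ → ℤ
  sgn zero x = x
  sgn (suc zero) x = ℤ.- x
  sgn (suc (suc j)) x = sgn j x

{-# OPTIONS --safe #-}

-- For odd k the window of the statement is [0, r_k), for even k it is
-- [r_{k-1} - r_k, r_{k-1}); both have length r_k. Windows are built two lengths
-- at a time from r_{k+2} = a_{k+1} r_{k+1} + r_k. The first r_k integers of
-- window k+2 are those of window k, shifted by appending the digits
-- (a_k, a_{k+1}) when k is even and (0, 0) when k is odd. Division with
-- remainder by r_{k+1} writes each of the remaining a_{k+1} r_{k+1} integers as
-- a point of window k+1 plus a multiple of r_{k+1}, which is absorbed by one
-- appended digit b_{k+1}: a_{k+1} - 1 - q for even k, q + 1 for odd k; the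
-- condition a_i ≥ 1 makes all these digit choices admissible.

module Submission where

open import Defs
open import Data.Nat as ℕ using (ℕ; _<_)
open import Data.Integer as ℤ using (ℤ; +_; _-_; _≤_)
open import Data.Product using (_×_; ∃-syntax)
open import Relation.Binary.PropositionalEquality using (_≡_)

open import Data.Nat using (zero; suc; pred; z≤n; s≤s; _<?_; NonZero; >-nonZero)
import Data.Nat.Properties as ℕ
open import Data.Nat.DivMod
  using (_/_; _%_; m≡m%n+[m/n]*n; m%n<n; m<n*o⇒m/o<n; m*n%n≡0; [m+kn]%n≡m%n)
open import Data.Integer using (-_; _+_; _*_)
import Data.Integer.Properties as ℤ
open import Data.Integer.Tactic.RingSolver using (solve-∀; solve)
open import Data.List using (_∷_; [])
open import Data.Product using (_,_)
open import Data.Sum using (inj₁; inj₂)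
open import Data.Empty using (⊥; ⊥-elim)
open import Function using (_∘_)
open import Relation.Nullary using (yes; no)
open import Relation.Binary.PropositionalEquality
  using (refl; sym; trans; cong; cong₂; subst; subst₂; module ≡-Reasoning)

sign : ℕ → ℤ → ℤ
sign zero x = x
sign (suc zero) x = - x
sign (suc (suc i)) x = sign i x

sign-unique : (s : ℕ → ℤ → ℤ) → (∀ x → s 0 x ≡ x) → (∀ x → s 1 x ≡ - x) →
              (∀ i x → s (suc (suc i)) x ≡ s i x) → ∀ i x → s i x ≡ sign i x
sign-unique s s0 s1 s2 zero x = s0 x
sign-unique s s0 s1 s2 (suc zero) x = s1 x
sign-unique s s0 s1 s2 (suc (suc i)) x = trans (s2 i x) (sign-unique s s0 s1 s2 i x)

-- The sign used by altSum is a where-local function of Defs and cannot be named;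
-- defs-sign is that function, found by unification in altSum-suc. Abstracting
-- the length with 'with' separates the where-block parameter from the index of
-- the sign, so that sign-unique applies.
mutual
  defs-sign : (ℕ → ℕ) → (ℕ → ℕ) → ℕ → ℕ → ℤ → ℤ
  defs-sign = _

  altSum-suc : ∀ a b m → altSum a b (suc m) ≡ altSum a b m + sign m (+ (b m ℕ.* r a m))
  altSum-suc a b zero = refl
  altSum-suc a b (suc zero) = refl
  altSum-suc a b (suc (suc i)) with suc (suc i) | + (b (suc (suc i)) ℕ.* r a (suc (suc i)))
  ... | m | x = cong (_+_ (altSum a b (suc (suc i))))
                  (sign-unique (defs-sign a b m) (λ _ → refl) (λ _ → refl) (λ _ _ → refl) i x)

-- Lengths are written j * 2 and suc (j * 2) because suc j * 2 reduces to
-- suc (suc (j * 2)).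
sign-even : ∀ j x → sign (j ℕ.* 2) x ≡ x
sign-even zero x = refl
sign-even (suc j) x = sign-even j x

sign-odd : ∀ j x → sign (suc (j ℕ.* 2)) x ≡ - x
sign-odd zero x = refl
sign-odd (suc j) x = sign-odd j x

even-not-odd : ∀ j → Odd (j ℕ.* 2) → ⊥
even-not-odd j odd with trans (sym (m*n%n≡0 j 2)) odd
... | ()

odd-not-even : ∀ j → Even (suc (j ℕ.* 2)) → ⊥
odd-not-even j even with trans (sym ([m+kn]%n≡m%n 1 j 2)) even
... | ()

extend : (ℕ → ℕ) → ℕ → ℕ → ℕ → ℕ
extend b k v i with i <? k
... | yes _ = b i
... | no _ = v

extend-< : ∀ b {k} v {i} → i < k → extend b k v i ≡ b i
extend-< b {k} v {i} i<k with i <? k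
... | yes _ = refl
... | no i≮k = ⊥-elim (i≮k i<k)

extend-self : ∀ b k v → extend b k v k ≡ v
extend-self b k v with k <? k
... | yes k<k = ⊥-elim (ℕ.<-irrefl refl k<k)
... | no _ = refl

altSum-cong : ∀ a {b c} m → (∀ i → i < m → b i ≡ c i) → altSum a b m ≡ altSum a c m
altSum-cong a zero b≗c = refl
altSum-cong a {b} {c} (suc m) b≗c = begin
  altSum a b (suc m)                            ≡⟨ altSum-suc a b m ⟩
  altSum a b m + sign m (+ (b m ℕ.* r a m))     ≡⟨ cong₂ (λ s d → s + sign m (+ (d ℕ.* r a m)))
                                                     (altSum-cong a m (λ i → b≗c i ∘ ℕ.m<n⇒m<1+n))
                                                     (b≗c m ℕ.≤-refl) ⟩
  altSum a c m + sign m (+ (c m ℕ.* r a m))     ≡⟨ sym (altSum-suc a c m) ⟩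
  altSum a c (suc m)                            ∎
  where open ≡-Reasoning

altSum-extend : ∀ a b k v → altSum a (extend b k v) (suc k) ≡ altSum a b k + sign k (+ v * + r a k)
altSum-extend a b k v = begin
  altSum a (extend b k v) (suc k)
    ≡⟨ altSum-suc a (extend b k v) k ⟩
  altSum a (extend b k v) k + sign k (+ (extend b k v k ℕ.* r a k))
    ≡⟨ cong₂ (λ s d → s + sign k d)
         (altSum-cong a k (λ i → extend-< b v))
         (trans (cong (λ d → + (d ℕ.* r a k)) (extend-self b k v)) (ℤ.pos-* v (r a k))) ⟩
  altSum a b k + sign k (+ v * + r a k) ∎
  where open ≡-Reasoning

altSum-extend-even : ∀ a b j v →
  altSum a (extend b (j ℕ.* 2) v) (suc (j ℕ.* 2)) ≡ altSum a b (j ℕ.* 2) + + v * + r a (j ℕ.* 2)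
altSum-extend-even a b j v =
  trans (altSum-extend a b (j ℕ.* 2) v) (cong (_+_ (altSum a b (j ℕ.* 2))) (sign-even j _))

altSum-extend-odd : ∀ a b j v →
  altSum a (extend b (suc (j ℕ.* 2)) v) (suc (suc (j ℕ.* 2)))
    ≡ altSum a b (suc (j ℕ.* 2)) - + v * + r a (suc (j ℕ.* 2))
altSum-extend-odd a b j v =
  trans (altSum-extend a b (suc (j ℕ.* 2)) v)
        (cong (_+_ (altSum a b (suc (j ℕ.* 2)))) (sign-odd j _))

extend-≤ : ∀ {k} (c : ℕ → ℕ) {b v} → (∀ i → i < k → b i ℕ.≤ c i) → v ℕ.≤ c k →
  ∀ i → i < suc k → extend b k v i ℕ.≤ c i
extend-≤ {k} c {b} {v} b≤c v≤c i i<1+k with ℕ.m<1+n⇒m<n∨m≡n i<1+k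
... | inj₁ i<k = subst (ℕ._≤ c i) (sym (extend-< b v i<k)) (b≤c i i<k)
... | inj₂ refl = subst (ℕ._≤ c k) (sym (extend-self b k v)) v≤c

extend-link : ∀ {k} (Q : ℕ → Set) (c : ℕ → ℕ) {b v} →
  (∀ i → suc i < k → Q (suc i) → b (suc i) ≡ c (suc i) → b i ≡ c i) →
  (Q k → v ≡ c k → ∀ {i} → suc i ≡ k → b i ≡ c i) →
  ∀ i → suc i < suc k → Q (suc i) → extend b k v (suc i) ≡ c (suc i) → extend b k v i ≡ c i
extend-link {k} Q c {b} {v} link link-k i 1+i<1+k q eq with ℕ.m<1+n⇒m<n∨m≡n 1+i<1+k
... | inj₁ 1+i<k = trans (extend-< b v (ℕ.<-trans (ℕ.n<1+n i) 1+i<k))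
                         (link i 1+i<k q (trans (sym (extend-< b v 1+i<k)) eq))
... | inj₂ refl = trans (extend-< b v (ℕ.n<1+n i))
                        (link-k q (trans (sym (extend-self b k v)) eq) refl)

admissible-extend : ∀ {k a b v} → Admissible k a b → v ℕ.≤ a k →
  (Odd k → v ≡ a k → ∀ {i} → suc i ≡ k → b i ≡ a i) →
  (Even k → v ≡ 0 → ∀ {i} → suc i ≡ k → b i ≡ 0) →
  Admissible (suc k) a (extend b k v)
admissible-extend {a = a} (b≤a , full , empty) v≤a full-k empty-k =
  extend-≤ a b≤a v≤a , extend-link Odd a full full-k , extend-link Even (λ _ → 0) empty empty-k

admissible-extend-even : ∀ {a b v} j → Admissible (j ℕ.* 2) a b → v ℕ.≤ a (j ℕ.* 2) →
  (v ≡ 0 → ∀ {i} → suc i ≡ j ℕ.* 2 → b i ≡ 0) →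
  Admissible (suc (j ℕ.* 2)) a (extend b (j ℕ.* 2) v)
admissible-extend-even j adm v≤a empty-k =
  admissible-extend adm v≤a (⊥-elim ∘ even-not-odd j) (λ _ → empty-k)

admissible-extend-odd : ∀ {a b v} j → Admissible (suc (j ℕ.* 2)) a b → v ℕ.≤ a (suc (j ℕ.* 2)) →
  (v ≡ a (suc (j ℕ.* 2)) → b (j ℕ.* 2) ≡ a (j ℕ.* 2)) →
  Admissible (suc (suc (j ℕ.* 2))) a (extend b (suc (j ℕ.* 2)) v)
admissible-extend-odd j adm v≤a full-k =
  admissible-extend adm v≤a (λ _ v≡a → λ { refl → full-k v≡a }) (⊥-elim ∘ odd-not-even j)

r-positive : ∀ a k → 0 < r a k
r-positive a zero = s≤s z≤n
r-positive a (suc zero) = ℕ.m≤n+m 1 (a 0 ℕ.* 1)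
r-positive a (suc (suc k)) = ℕ.≤-trans (r-positive a k) (ℕ.m≤n+m (r a k) _)

r-nonZero : ∀ a k → NonZero (r a k)
r-nonZero a k = >-nonZero (r-positive a k)

r-suc : ∀ a k → + r a (suc k) ≡ + a k * + r a k + + r a (pred k)
r-suc a zero = cong (_+ + 1) (ℤ.pos-* (a 0) 1)
r-suc a (suc k) = cong (_+ + r a k) (ℤ.pos-* (a (suc k)) (r a (suc k)))

split-bound : ∀ {P : ℕ → Set} r₀ R A .{{_ : NonZero R}} →
  (∀ t → t < r₀ → P t) →
  (∀ q v → q < A → v < R → P (r₀ ℕ.+ (v ℕ.+ q ℕ.* R))) →
  ∀ t → t < A ℕ.* R ℕ.+ r₀ → P t
split-bound {P} r₀ R A below above t t<bound with t <? r₀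
... | yes t<r₀ = below t t<r₀
... | no t≮r₀ = subst P t≡ (above (u / R) (u % R) (m<n*o⇒m/o<n u<A*R) (m%n<n u R))
  where
  u : ℕ
  u = t ℕ.∸ r₀
  r₀+u≡t : r₀ ℕ.+ u ≡ t
  r₀+u≡t = ℕ.m+[n∸m]≡n (ℕ.≮⇒≥ t≮r₀)
  u<A*R : u < A ℕ.* R
  u<A*R = ℕ.+-cancelˡ-< r₀ u (A ℕ.* R)
            (subst₂ _<_ (sym r₀+u≡t) (ℕ.+-comm (A ℕ.* R) r₀) t<bound)
  t≡ : r₀ ℕ.+ (u % R ℕ.+ u / R ℕ.* R) ≡ t
  t≡ = trans (cong (r₀ ℕ.+_) (sym (m≡m%n+[m/n]*n u R))) r₀+u≡t

Representable : (ℕ → ℕ) → ℕ → ℤ → Set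
Representable a k n = ∃[ b ] (Admissible k a b × n ≡ altSum a b k)

Covers : (ℕ → ℕ) → ℕ → ℤ → Set
Covers a k lo = ∀ t → t < r a k → Representable a k (lo + + t)

evenLow : (ℕ → ℕ) → ℕ → ℤ
evenLow a k = + r a (pred k) - + r a k

private
  even-low-identity : ∀ r₋ r₀ {r₁ r₂} c₀ c₁ t → r₁ ≡ c₀ * r₀ + r₋ → r₂ ≡ c₁ * r₁ + r₀ →
    r₁ - r₂ + t ≡ (r₋ - r₀ + t) + c₀ * r₀ - c₁ * r₁
  even-low-identity r₋ r₀ c₀ c₁ t refl refl = solve (r₋ ∷ r₀ ∷ c₀ ∷ c₁ ∷ t ∷ [])

  even-high-identity : ∀ r₀ r₁ {r₂ c} q w v → r₂ ≡ c * r₁ + r₀ → c ≡ + 1 + q + w →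
    r₁ - r₂ + (r₀ + (v + q * r₁)) ≡ v - w * r₁
  even-high-identity r₀ r₁ q w v refl refl = solve (r₀ ∷ r₁ ∷ q ∷ w ∷ v ∷ [])

  odd-high-identity : ∀ r₁ r₂ q v → r₁ + (v + q * r₂) ≡ (r₁ - r₂ + v) + (+ 1 + q) * r₂
  odd-high-identity = solve-∀

  add-sub-cancel : ∀ i j → i + (j - i) ≡ j
  add-sub-cancel = solve-∀

  add-sub-cancelˡ : ∀ i j → i + j - i ≡ j
  add-sub-cancelˡ = solve-∀

  sub-add-cancel : ∀ i j → i - j + j ≡ i
  sub-add-cancel = solve-∀

covers-zero : ∀ a → Covers a 0 (evenLow a 0)
covers-zero a zero _ = (λ _ → 0) , ((λ _ ()) , (λ _ ()) , (λ _ ())) , refl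
covers-zero a (suc t) (s≤s ())

covers-one : ∀ a → Covers a 1 (+ 0)
covers-one a t t<r =
  (λ _ → t) , (t≤a , (λ { _ (s≤s ()) }) , (λ { _ (s≤s ()) })) , cong +_ (sym (ℕ.*-identityʳ t))
  where
  t≤a : ∀ i → i < 1 → t ℕ.≤ a i
  t≤a zero _ =
    ℕ.≤-pred (subst (t <_) (trans (ℕ.+-comm (a 0 ℕ.* 1) 1) (cong suc (ℕ.*-identityʳ (a 0)))) t<r)
  t≤a (suc _) (s≤s ())

covers⇒representable : ∀ {a k lo n} → Covers a k lo → lo ≤ n → n ℤ.< lo + + r a k →
  Representable a k n
covers⇒representable {a} {k} {lo} {n} covers lo≤n n<lo+r =
  subst (Representable a k) lo+t≡n (covers t t<r)
  where
  t : ℕ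
  t = ℤ.∣ n - lo ∣
  t≡n-lo : + t ≡ n - lo
  t≡n-lo = ℤ.0≤i⇒+∣i∣≡i (ℤ.i≤j⇒0≤j-i lo≤n)
  lo+t≡n : lo + + t ≡ n
  lo+t≡n = trans (cong (_+_ lo) t≡n-lo) (add-sub-cancel lo n)
  t<r : t < r a k
  t<r = ℤ.drop‿+<+
    (subst₂ ℤ._<_ (sym t≡n-lo) (add-sub-cancelˡ lo (+ r a k)) (ℤ.+-monoˡ-< (- lo) n<lo+r))

module _ (a : ℕ → ℕ) (j : ℕ) where
  private
    K : ℕ
    K = j ℕ.* 2

  covers-even-low : (1 ℕ.≤ K → 1 ℕ.≤ a K) → Covers a K (evenLow a K) →
    ∀ t → t < r a K → Representable a (suc (suc K)) (evenLow a (suc (suc K)) + + t)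
  covers-even-low a-pos covers t t<r with covers t t<r
  ... | b , adm , eq = extend b′ (suc K) (a (suc K)) , adm″ , value
    where
    open ≡-Reasoning
    b′ : ℕ → ℕ
    b′ = extend b K (a K)
    adm″ : Admissible (suc (suc K)) a (extend b′ (suc K) (a (suc K)))
    adm″ = admissible-extend-odd j
             (admissible-extend-even j adm ℕ.≤-refl
               (λ aK≡0 1+i≡K → ⊥-elim (ℕ.<⇒≢ (a-pos (subst (1 ℕ.≤_) 1+i≡K (s≤s z≤n))) (sym aK≡0))))
             ℕ.≤-refl (λ _ → extend-self b K (a K))
    value : evenLow a (suc (suc K)) + + t ≡ altSum a (extend b′ (suc K) (a (suc K))) (suc (suc K))
    value = begin
      evenLow a (suc (suc K)) + + t
        ≡⟨ even-low-identity (+ r a (pred K)) (+ r a K) (+ a K) (+ a (suc K)) (+ t)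
             (r-suc a K) (r-suc a (suc K)) ⟩
      (evenLow a K + + t) + + a K * + r a K - + a (suc K) * + r a (suc K)
        ≡⟨ cong (λ s → s + + a K * + r a K - + a (suc K) * + r a (suc K)) eq ⟩
      altSum a b K + + a K * + r a K - + a (suc K) * + r a (suc K)
        ≡⟨ cong (_- + a (suc K) * + r a (suc K)) (sym (altSum-extend-even a b j (a K))) ⟩
      altSum a b′ (suc K) - + a (suc K) * + r a (suc K)
        ≡⟨ sym (altSum-extend-odd a b′ j (a (suc K))) ⟩
      altSum a (extend b′ (suc K) (a (suc K))) (suc (suc K)) ∎

  covers-even-high : Covers a (suc K) (+ 0) → ∀ q v → q < a (suc K) → v < r a (suc K) →
    Representable a (suc (suc K))
      (evenLow a (suc (suc K)) + + (r a K ℕ.+ (v ℕ.+ q ℕ.* r a (suc K))))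
  covers-even-high covers q v q<a v<r with covers v v<r
  ... | b , adm , eq =
    extend b (suc K) w , admissible-extend-odd j adm (ℕ.<⇒≤ w<a) (⊥-elim ∘ ℕ.<⇒≢ w<a) , value
    where
    open ≡-Reasoning
    w : ℕ
    w = a (suc K) ℕ.∸ suc q
    a≡1+q+w : suc q ℕ.+ w ≡ a (suc K)
    a≡1+q+w = ℕ.m+[n∸m]≡n q<a
    w<a : w < a (suc K)
    w<a = subst (w <_) a≡1+q+w (ℕ.m<n+m w (s≤s z≤n))
    value : evenLow a (suc (suc K)) + + (r a K ℕ.+ (v ℕ.+ q ℕ.* r a (suc K)))
              ≡ altSum a (extend b (suc K) w) (suc (suc K))
    value = begin
      evenLow a (suc (suc K)) + + (r a K ℕ.+ (v ℕ.+ q ℕ.* r a (suc K)))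
        ≡⟨ cong (λ x → evenLow a (suc (suc K)) + (+ r a K + (+ v + x))) (ℤ.pos-* q (r a (suc K))) ⟩
      evenLow a (suc (suc K)) + (+ r a K + (+ v + + q * + r a (suc K)))
        ≡⟨ even-high-identity (+ r a K) (+ r a (suc K)) (+ q) (+ w) (+ v)
             (r-suc a (suc K)) (cong +_ (sym a≡1+q+w)) ⟩
      + v - + w * + r a (suc K)
        ≡⟨ cong (_- + w * + r a (suc K)) eq ⟩
      altSum a b (suc K) - + w * + r a (suc K)
        ≡⟨ sym (altSum-extend-odd a b j w) ⟩
      altSum a (extend b (suc K) w) (suc (suc K)) ∎

  covers-odd-low : 1 ℕ.≤ a (suc K) → Covers a (suc K) (+ 0) →
    ∀ t → t < r a (suc K) → Representable a (suc (suc (suc K))) (+ t)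
  covers-odd-low a-pos covers t t<r with covers t t<r
  ... | b , adm , eq = extend b′ (suc (suc K)) 0 , adm″ , value
    where
    open ≡-Reasoning
    b′ : ℕ → ℕ
    b′ = extend b (suc K) 0
    adm″ : Admissible (suc (suc (suc K))) a (extend b′ (suc (suc K)) 0)
    adm″ = admissible-extend-even (suc j)
             (admissible-extend-odd j adm z≤n (⊥-elim ∘ ℕ.<⇒≢ a-pos))
             z≤n (λ _ 1+i≡2+K → trans (cong b′ (ℕ.suc-injective 1+i≡2+K)) (extend-self b (suc K) 0))
    value : + t ≡ altSum a (extend b′ (suc (suc K)) 0) (suc (suc (suc K)))
    value = begin
      + t
        ≡⟨ eq ⟩
      altSum a b (suc K)
        ≡⟨ sym (ℤ.+-identityʳ _) ⟩
      altSum a b (suc K) - + 0 * + r a (suc K)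
        ≡⟨ sym (altSum-extend-odd a b j 0) ⟩
      altSum a b′ (suc (suc K))
        ≡⟨ sym (ℤ.+-identityʳ _) ⟩
      altSum a b′ (suc (suc K)) + + 0 * + r a (suc (suc K))
        ≡⟨ sym (altSum-extend-even a b′ (suc j) 0) ⟩
      altSum a (extend b′ (suc (suc K)) 0) (suc (suc (suc K))) ∎

  covers-odd-high : Covers a (suc (suc K)) (evenLow a (suc (suc K))) →
    ∀ q v → q < a (suc (suc K)) → v < r a (suc (suc K)) →
    Representable a (suc (suc (suc K))) (+ (r a (suc K) ℕ.+ (v ℕ.+ q ℕ.* r a (suc (suc K)))))
  covers-odd-high covers q v q<a v<r with covers v v<r
  ... | b , adm , eq =
    extend b (suc (suc K)) (suc q) , admissible-extend-even (suc j) adm q<a (λ ()) , value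
    where
    open ≡-Reasoning
    value : + (r a (suc K) ℕ.+ (v ℕ.+ q ℕ.* r a (suc (suc K))))
              ≡ altSum a (extend b (suc (suc K)) (suc q)) (suc (suc (suc K)))
    value = begin
      + (r a (suc K) ℕ.+ (v ℕ.+ q ℕ.* r a (suc (suc K))))
        ≡⟨ cong (λ x → + r a (suc K) + (+ v + x)) (ℤ.pos-* q (r a (suc (suc K)))) ⟩
      + r a (suc K) + (+ v + + q * + r a (suc (suc K)))
        ≡⟨ odd-high-identity (+ r a (suc K)) (+ r a (suc (suc K))) (+ q) (+ v) ⟩
      (evenLow a (suc (suc K)) + + v) + + suc q * + r a (suc (suc K))
        ≡⟨ cong (_+ + suc q * + r a (suc (suc K))) eq ⟩
      altSum a b (suc (suc K)) + + suc q * + r a (suc (suc K))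
        ≡⟨ sym (altSum-extend-even a b (suc j) (suc q)) ⟩
      altSum a (extend b (suc (suc K)) (suc q)) (suc (suc (suc K))) ∎

  covers-even-step : (1 ℕ.≤ K → 1 ℕ.≤ a K) → Covers a K (evenLow a K) → Covers a (suc K) (+ 0) →
    Covers a (suc (suc K)) (evenLow a (suc (suc K)))
  covers-even-step a-pos covers-K covers-1+K =
    split-bound (r a K) (r a (suc K)) (a (suc K)) {{r-nonZero a (suc K)}}
      (covers-even-low a-pos covers-K) (covers-even-high covers-1+K)

  covers-odd-step : 1 ℕ.≤ a (suc K) → Covers a (suc (suc K)) (evenLow a (suc (suc K))) →
    Covers a (suc K) (+ 0) → Covers a (suc (suc (suc K))) (+ 0)
  covers-odd-step a-pos covers-2+K covers-1+K =
    split-bound (r a (suc K)) (r a (suc (suc K))) (a (suc (suc K))) {{r-nonZero a (suc (suc K))}}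
      (covers-odd-low a-pos covers-1+K) (covers-odd-high covers-2+K)

PositivePartialQuotients : ℕ → (ℕ → ℕ) → Set
PositivePartialQuotients k a = ∀ i → 1 ℕ.≤ i → i < k → 1 ℕ.≤ a i

positive-≤ : ∀ {k k′ a} → k′ ℕ.≤ k → PositivePartialQuotients k a → PositivePartialQuotients k′ a
positive-≤ k′≤k pos i 1≤i i<k′ = pos i 1≤i (ℕ.<-≤-trans i<k′ k′≤k)

mutual
  covers-even : ∀ a j → PositivePartialQuotients (j ℕ.* 2) a →
    Covers a (j ℕ.* 2) (evenLow a (j ℕ.* 2))
  covers-even a zero _ = covers-zero a
  covers-even a (suc j) pos =
    covers-even-step a j (λ 1≤K → pos _ 1≤K (ℕ.m<n+m _ (s≤s z≤n)))
      (covers-even a j (positive-≤ (ℕ.m≤n+m _ 2) pos))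
      (covers-odd a j (positive-≤ (ℕ.n≤1+n (suc (j ℕ.* 2))) pos))

  covers-odd : ∀ a j → PositivePartialQuotients (suc (j ℕ.* 2)) a → Covers a (suc (j ℕ.* 2)) (+ 0)
  covers-odd a zero _ = covers-one a
  covers-odd a (suc j) pos =
    covers-odd-step a j (pos (suc (j ℕ.* 2)) (s≤s z≤n) (ℕ.m<n+m (suc (j ℕ.* 2)) {2} (s≤s z≤n)))
      (covers-even a (suc j) (positive-≤ (ℕ.n≤1+n _) pos))
      (covers-odd a j (positive-≤ (ℕ.m≤n+m _ 2) pos))

lemma4p3 : (k : ℕ) (a : ℕ → ℕ) → IsPosCF k a →
    ((Odd k → (n : ℤ) → + 0 ≤ n → n ℤ.< + r a k →
        ∃[ b ] (Admissible k a b × n ≡ altSum a b k))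
    × (Even k → (n : ℤ) → + r a (ℕ.pred k) - + r a k ≤ n → n ℤ.< + r a (ℕ.pred k) →
        ∃[ b ] (Admissible k a b × n ≡ altSum a b k)))
-- Neither k ≥ 1 nor the positivity of the value is needed.
lemma4p3 k a (_ , pos , _) = odd-case , even-case
  where
  k≡ : k ≡ k % 2 ℕ.+ k / 2 ℕ.* 2
  k≡ = m≡m%n+[m/n]*n k 2

  odd-case : Odd k → (n : ℤ) → + 0 ≤ n → n ℤ.< + r a k → Representable a k n
  odd-case k-odd n 0≤n n<r = covers⇒representable covers 0≤n n<r
    where
    covers : Covers a k (+ 0)
    covers = subst (λ k → PositivePartialQuotients k a → Covers a k (+ 0))
               (sym (trans k≡ (cong (ℕ._+ k / 2 ℕ.* 2) k-odd))) (covers-odd a (k / 2)) pos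

  even-case : Even k → (n : ℤ) → evenLow a k ≤ n → n ℤ.< + r a (pred k) → Representable a k n
  even-case k-even n lo≤n n<r =
    covers⇒representable covers lo≤n
      (subst (n ℤ.<_) (sym (sub-add-cancel (+ r a (pred k)) (+ r a k))) n<r)
    where
    covers : Covers a k (evenLow a k)
    covers = subst (λ k → PositivePartialQuotients k a → Covers a k (evenLow a k))
               (sym (trans k≡ (cong (ℕ._+ k / 2 ℕ.* 2) k-even))) (covers-even a (k / 2)) pos
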